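{- Let $X$ be a finite $r$-regular graph. Then $X$ has a non-trivial efficient dominating function, i.e. there exist nonnegative integers $j$ and $k\geq 1$ and a non-constant efficient $(j,k)$-dominating function on $X$, if and only if $-1$ is an eigenvalue of the adjacency matrix of $X$.
   Context: For a graph $X$ and vertex $v$, $N[v]$ denotes the closed neighbourhood of $v$, and for $f:V(X)\to\mathbb{R}$ and $S\subseteq V(X)$, $f(S)=\sum_{u\in S}f(u)$. For nonnegative integers $j,k$, a $(j,k)$-dominating function on $X$ is a function $f:V(X)\to\{0,1,\ldots,j\}$ with $f(N[v])\geq k$ for every vertex $v$; it is efficient if $f(N[v])=k$ for every vertex $v$. An efficient dominating function is called trivial if it is constant on $V(X)$. -}

module Defs where

open import Data.Bool using (Bool; true; false; if_then_else_)
open import Data.Nat as ℕ using (ℕ; zero; suc)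
open import Data.Fin using (Fin; zero; suc)
open import Data.Rational as ℚ using (ℚ; 0ℚ; 1ℚ)
open import Data.Product using (Σ; _×_; ∃; ∃-syntax; Σ-syntax)
open import Relation.Binary.PropositionalEquality using (_≡_; _≢_)

sumℕ : ∀ {n} → (Fin n → ℕ) → ℕ
sumℕ {zero}  f = 0
sumℕ {suc n} f = f zero ℕ.+ sumℕ (λ i → f (suc i))

sumℚ : ∀ {n} → (Fin n → ℚ) → ℚ
sumℚ {zero}  f = 0ℚ
sumℚ {suc n} f = f zero ℚ.+ sumℚ (λ i → f (suc i))

record Graph (n : ℕ) : Set where
  field
    adj     : Fin n → Fin n → Bool
    symm    : ∀ u v → adj u v ≡ adj v u
    irrefl  : ∀ v → adj v v ≡ false
open Graph public

degree : ∀ {n} → Graph n → Fin n → ℕ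
degree X v = sumℕ (λ u → if adj X v u then 1 else 0)

Regular : ∀ {n} → Graph n → ℕ → Set
Regular X r = ∀ v → degree X v ≡ r

closedNbhdSum : ∀ {n} → Graph n → (Fin n → ℕ) → Fin n → ℕ
closedNbhdSum X f v = f v ℕ.+ sumℕ (λ u → if adj X v u then f u else 0)

EfficientDominating : ∀ {n} → Graph n → ℕ → ℕ → (Fin n → ℕ) → Set
EfficientDominating X j k f =
  (∀ v → f v ℕ.≤ j) × (∀ v → closedNbhdSum X f v ≡ k)

NonConstant : ∀ {n} {A : Set} → (Fin n → A) → Set
NonConstant f = ∃[ u ] ∃[ v ] (f u ≢ f v)

adjMatrix : ∀ {n} → Graph n → Fin n → Fin n → ℚ
adjMatrix X u v = if adj X u v then 1ℚ else 0ℚ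

IsEigenvalue : ∀ {n} → (Fin n → Fin n → ℚ) → ℚ → Set
IsEigenvalue {n} M λ₀ = Σ[ x ∈ (Fin n → ℚ) ] ((∃[ i ] (x i ≢ 0ℚ)) ×
  (∀ i → sumℚ (λ j → M i j ℚ.* x j) ≡ λ₀ ℚ.* x i))

module Submission where

-- If f is efficient with f(N[v]) = k, then g = (r+1) f - k satisfies
-- g(N[v]) = (r+1) k - k (r+1) = 0 at every vertex, i.e. A g = -g, and g ≠ 0 as
-- soon as f is non-constant. Conversely a rational (-1)-eigenvector can be scaled
-- to an integer vector z with z(N[v]) = 0 everywhere; for a large constant c,
-- z + c is an efficient (k, k)-dominating function with k = c (r+1), and it is
-- non-constant because a constant vector c has closed sums c (r+1) ≠ 0.

open import Defs
open import Data.Bool using (true; false; if_then_else_)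
open import Data.Bool.Properties using (if-float)
open import Data.Nat as ℕ using (ℕ; zero; suc; _≤_)
import Data.Nat.Properties as ℕP
open import Data.Nat.Divisibility using (_∣_; divides)
import Data.Nat.Coprimality as Coprime
open import Data.Nat.ListAction using (product)
open import Data.Nat.ListAction.Properties using (∈⇒∣product; product≢0)
open import Data.List.Base using (tabulate)
open import Data.List.Membership.Propositional.Properties using (∈-tabulate⁺)
import Data.List.Relation.Unary.All.Properties as All
open import Data.List.Extrema.Nat using (max; xs≤max)
open import Data.Fin using (Fin; zero; suc)
import Data.Fin.Properties as FinP
open import Data.Integer as ℤ using (ℤ; +_; -[1+_]; 0ℤ; 1ℤ; -1ℤ; _+_; _*_)
import Data.Integer.Properties as ℤP
open import Data.Integer.Tactic.RingSolver using (solve-∀)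
open import Data.Rational as ℚ using (ℚ; mkℚ; 0ℚ; 1ℚ; ↥_; ↧_; ↧ₙ_; -_; 1/_)
import Data.Rational.Properties as ℚP
import Data.Rational.Unnormalised as ℚᵘ
import Data.Rational.Unnormalised.Properties as ℚᵘP
open import Algebra.Bundles using (CommutativeRing; CommutativeMonoid; AbelianGroup)
open import Algebra.Properties.Group (AbelianGroup.group ℤP.+-0-abelianGroup)
  using (∙-cancelʳ; inverseʳ-unique)
import Algebra.Properties.Semiring.Sum as SemiringSum
import Algebra.Properties.CommutativeSemigroup as CommSemigroupProperties
open import Data.Product using (_×_; _,_; proj₁; proj₂; ∃-syntax; Σ-syntax)
open import Function using (_∘_)
open import Function.Bundles using (_⇔_; mk⇔; Equivalence)
open import Function.Construct.Composition using (_⇔-∘_)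
open import Function.Construct.Symmetry using (⇔-sym)
open import Relation.Nullary using (yes; no; contradiction)
open import Relation.Binary.PropositionalEquality

module ∑ℤ = SemiringSum ℤP.+-*-semiring
module ∑ℚ = SemiringSum (CommutativeRing.semiring ℚP.+-*-commutativeRing)
open CommSemigroupProperties (CommutativeMonoid.commutativeSemigroup ℚP.*-1-commutativeMonoid)
  using () renaming (x∙yz≈y∙xz to ℚ-*-swapˡ)

-- z / 1 (mkℚ stores the denominator minus one)
fromℤ : ℤ → ℚ
fromℤ z = mkℚ z 0 (Coprime.sym (Coprime.1-coprimeTo _))

fromℤ-injective : ∀ {a b} → fromℤ a ≡ fromℤ b → a ≡ b
fromℤ-injective = cong ↥_

fromℤ-homo-+ : ∀ a b → fromℤ (a + b) ≡ fromℤ a ℚ.+ fromℤ b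
fromℤ-homo-+ a b = ℚP.toℚᵘ-injective
  (ℚᵘP.≃-trans (ℚᵘ.*≡* (identity a b)) (ℚᵘP.≃-sym (ℚP.toℚᵘ-homo-+ (fromℤ a) (fromℤ b))))
  where
  identity : ∀ a b → (a + b) * 1ℤ ≡ (a * 1ℤ + b * 1ℤ) * 1ℤ
  identity = solve-∀

fromℤ-homo-* : ∀ a b → fromℤ (a * b) ≡ fromℤ a ℚ.* fromℤ b
fromℤ-homo-* a b = ℚP.toℚᵘ-injective
  (ℚᵘP.≃-trans (ℚᵘ.*≡* refl) (ℚᵘP.≃-sym (ℚP.toℚᵘ-homo-* (fromℤ a) (fromℤ b))))

fromℤ-numerator : ∀ q → fromℤ (↥ q) ≡ fromℤ (↧ q) ℚ.* q
fromℤ-numerator q@(mkℚ _ _ _) = ℚP.toℚᵘ-injective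
  (ℚᵘP.≃-trans (ℚᵘ.*≡* (identity (↥ q) (↧ q))) (ℚᵘP.≃-sym (ℚP.toℚᵘ-homo-* (fromℤ (↧ q)) q)))
  where
  identity : ∀ n d → n * (1ℤ * d) ≡ (d * n) * 1ℤ
  identity = solve-∀

fromℤ-sum : ∀ {n} {g : Fin n → ℤ} {y : Fin n → ℚ} → (∀ i → fromℤ (g i) ≡ y i) →
            fromℤ (∑ℤ.sum g) ≡ sumℚ y
fromℤ-sum {zero}      g≡y = refl
fromℤ-sum {suc n} {g} g≡y =
  trans (fromℤ-homo-+ (g zero) (∑ℤ.sum (g ∘ suc))) (cong₂ ℚ._+_ (g≡y zero) (fromℤ-sum (g≡y ∘ suc)))

pos-sumℕ : ∀ {n} (f : Fin n → ℕ) → + sumℕ f ≡ ∑ℤ.sum (+_ ∘ f)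
pos-sumℕ {zero}  f = refl
pos-sumℕ {suc n} f = trans (ℤP.pos-+ (f zero) _) (cong (_+_ (+ f zero)) (pos-sumℕ (f ∘ suc)))

sumℚ≡sum : ∀ {n} (f : Fin n → ℚ) → sumℚ f ≡ ∑ℚ.sum f
sumℚ≡sum {zero}  f = refl
sumℚ≡sum {suc n} f = cong (f zero ℚ.+_) (sumℚ≡sum (f ∘ suc))

sumℚ-scale : ∀ {n} c (a x : Fin n → ℚ) →
             sumℚ (λ u → a u ℚ.* (c ℚ.* x u)) ≡ c ℚ.* sumℚ (λ u → a u ℚ.* x u)
sumℚ-scale c a x = begin
  sumℚ (λ u → a u ℚ.* (c ℚ.* x u))    ≡⟨ sumℚ≡sum (λ u → a u ℚ.* (c ℚ.* x u)) ⟩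
  ∑ℚ.sum (λ u → a u ℚ.* (c ℚ.* x u))  ≡⟨ ∑ℚ.sum-cong-≗ (λ u → ℚ-*-swapˡ (a u) c (x u)) ⟩
  ∑ℚ.sum (λ u → c ℚ.* (a u ℚ.* x u))  ≡⟨ sym (∑ℚ.*-distribˡ-sum c (λ u → a u ℚ.* x u)) ⟩
  c ℚ.* ∑ℚ.sum (λ u → a u ℚ.* x u)    ≡⟨ cong (c ℚ.*_) (sym (sumℚ≡sum (λ u → a u ℚ.* x u))) ⟩
  c ℚ.* sumℚ (λ u → a u ℚ.* x u)      ∎
  where open ≡-Reasoning

p≢0∧p*q≡0⇒q≡0 : ∀ {p q} → p ≢ 0ℚ → p ℚ.* q ≡ 0ℚ → q ≡ 0ℚ
p≢0∧p*q≡0⇒q≡0 {p} {q} p≢0 pq≡0 = begin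
  q                     ≡⟨ sym (ℚP.*-identityˡ q) ⟩
  1ℚ ℚ.* q              ≡⟨ cong (ℚ._* q) (sym (ℚP.*-inverseˡ p)) ⟩
  (1/ p) ℚ.* p ℚ.* q    ≡⟨ ℚP.*-assoc (1/ p) p q ⟩
  (1/ p) ℚ.* (p ℚ.* q)  ≡⟨ cong ((1/ p) ℚ.*_) pq≡0 ⟩
  (1/ p) ℚ.* 0ℚ         ≡⟨ ℚP.*-zeroʳ (1/ p) ⟩
  0ℚ                    ∎
  where
  open ≡-Reasoning
  instance _ = ℚ.≢-nonZero p≢0

denominator∣D⇒integral : ∀ q {D} → ↧ₙ q ∣ D → ∃[ w ] fromℤ w ≡ fromℤ (+ D) ℚ.* q
denominator∣D⇒integral q {D} (divides m D≡m*↧q) = + m * ↥ q , (begin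
  fromℤ (+ m * ↥ q)                     ≡⟨ fromℤ-homo-* (+ m) (↥ q) ⟩
  fromℤ (+ m) ℚ.* fromℤ (↥ q)           ≡⟨ cong (fromℤ (+ m) ℚ.*_) (fromℤ-numerator q) ⟩
  fromℤ (+ m) ℚ.* (fromℤ (↧ q) ℚ.* q)   ≡⟨ sym (ℚP.*-assoc (fromℤ (+ m)) (fromℤ (↧ q)) q) ⟩
  fromℤ (+ m) ℚ.* fromℤ (↧ q) ℚ.* q     ≡⟨ cong (ℚ._* q) (sym (fromℤ-homo-* (+ m) (↧ q))) ⟩
  fromℤ (+ m * ↧ q) ℚ.* q               ≡⟨ cong (λ d → fromℤ d ℚ.* q) (sym (ℤP.pos-* m (↧ₙ q))) ⟩
  fromℤ (+ (m ℕ.* ↧ₙ q)) ℚ.* q          ≡⟨ cong (λ d → fromℤ (+ d) ℚ.* q) (sym D≡m*↧q) ⟩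
  fromℤ (+ D) ℚ.* q                     ∎)
  where open ≡-Reasoning

clearDenominators : ∀ {n} (x : Fin n → ℚ) →
                    ∃[ c ] c ≢ 0ℚ × Σ[ z ∈ (Fin n → ℤ) ] ∀ i → fromℤ (z i) ≡ c ℚ.* x i
clearDenominators {n} x =
  fromℤ (+ D) , D≢0 ∘ ℤP.+-injective ∘ fromℤ-injective , proj₁ ∘ integral , proj₂ ∘ integral
  where
  D : ℕ
  D = product (tabulate {n = n} (↧ₙ_ ∘ x))
  D≢0 : D ≢ 0
  D≢0 = ℕ.≢-nonZero⁻¹ D {{product≢0 (All.tabulate⁺ {f = ↧ₙ_ ∘ x} (λ _ → _))}}
  integral : ∀ i → ∃[ w ] fromℤ w ≡ fromℤ (+ D) ℚ.* x i
  integral i = denominator∣D⇒integral (x i) (∈⇒∣product (∈-tabulate⁺ {f = ↧ₙ_ ∘ x} i))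

x+y≡0⇔y≡-1*x : ∀ x y → x + y ≡ 0ℤ ⇔ y ≡ -1ℤ * x
x+y≡0⇔y≡-1*x x y = mk⇔
  (λ x+y≡0 → trans (inverseʳ-unique x y x+y≡0) (sym (ℤP.-1*i≡-i x)))
  (λ y≡-x → trans (cong (_+_ x) (trans y≡-x (ℤP.-1*i≡-i x))) (ℤP.+-inverseʳ x))

shiftToℕ : ∀ a {c} → ℤ.∣ a ∣ ℕ.≤ c → ∃[ m ] + m ≡ a + + c
shiftToℕ (+ m)    {c} _   = m ℕ.+ c , refl
shiftToℕ -[1+ m ] {c} m<c = c ℕ.∸ suc m , sym (ℤP.⊖-≥ m<c)

NonZeroVector : ∀ {n} → (Fin n → ℤ) → Set
NonZeroVector z = ∃[ i ] z i ≢ 0ℤ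

nonConstant⇒nonZero : ∀ {n} {z : Fin n → ℤ} → NonConstant z → NonZeroVector z
nonConstant⇒nonZero {z = z} (u , v , zu≢zv) with z u ℤ.≟ 0ℤ
... | no  zu≢0 = u , zu≢0
... | yes zu≡0 = v , λ zv≡0 → zu≢zv (trans zu≡0 (sym zv≡0))

nonConstant-reflect : ∀ {n} {A B : Set} {f : Fin n → A} {g : Fin n → B} →
                      (∀ {u v} → f u ≡ f v → g u ≡ g v) → NonConstant g → NonConstant f
nonConstant-reflect f≡⇒g≡ (u , v , gu≢gv) = u , v , gu≢gv ∘ f≡⇒g≡

module _ {n} (X : Graph n) where

  nbhdSumℤ : (Fin n → ℤ) → Fin n → ℤ
  nbhdSumℤ g v = ∑ℤ.sum (λ u → if adj X v u then g u else 0ℤ)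

  closedNbhdSumℤ : (Fin n → ℤ) → Fin n → ℤ
  closedNbhdSumℤ g v = g v + nbhdSumℤ g v

  closedNbhdSumℤ-cong : ∀ {g h} → (∀ u → g u ≡ h u) → ∀ v → closedNbhdSumℤ g v ≡ closedNbhdSumℤ h v
  closedNbhdSumℤ-cong g≡h v =
    cong₂ _+_ (g≡h v) (∑ℤ.sum-cong-≗ (λ u → cong (if adj X v u then_else 0ℤ) (g≡h u)))

  pos-nbhdSum : ∀ (f : Fin n → ℕ) v →
                + sumℕ (λ u → if adj X v u then f u else 0) ≡ nbhdSumℤ (+_ ∘ f) v
  pos-nbhdSum f v =
    trans (pos-sumℕ (λ u → if adj X v u then f u else 0))
          (∑ℤ.sum-cong-≗ (λ u → if-float +_ (adj X v u)))

  pos-closedNbhdSum : ∀ (f : Fin n → ℕ) v → + closedNbhdSum X f v ≡ closedNbhdSumℤ (+_ ∘ f) v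
  pos-closedNbhdSum f v = trans (ℤP.pos-+ (f v) _) (cong (_+_ (+ f v)) (pos-nbhdSum f v))

  fromℤ-nbhdSum : ∀ {g : Fin n → ℤ} {y : Fin n → ℚ} → (∀ u → fromℤ (g u) ≡ y u) →
                  ∀ v → fromℤ (nbhdSumℤ g v) ≡ sumℚ (λ u → adjMatrix X v u ℚ.* y u)
  fromℤ-nbhdSum {g} {y} g≡y v =
    fromℤ-sum {y = λ u → adjMatrix X v u ℚ.* y u} (λ u → entry (adj X v u) u)
    where
    entry : ∀ b u → fromℤ (if b then g u else 0ℤ) ≡ (if b then 1ℚ else 0ℚ) ℚ.* y u
    entry true  u = trans (g≡y u) (sym (ℚP.*-identityˡ (y u)))
    entry false u = sym (ℚP.*-zeroˡ (y u))

  -- Since z(N[v]) = z v + (A z) v, these are the integral solutions of A z = -z.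
  ZeroClosedSums : (Fin n → ℤ) → Set
  ZeroClosedSums z = ∀ v → closedNbhdSumℤ z v ≡ 0ℤ

  ZeroClosedSumVector : Set
  ZeroClosedSumVector = Σ[ z ∈ (Fin n → ℤ) ] NonZeroVector z × ZeroClosedSums z

  eigenvalue-1⇒zeroClosedSumVector : IsEigenvalue (adjMatrix X) (- 1ℚ) → ZeroClosedSumVector
  eigenvalue-1⇒zeroClosedSumVector (x , (i , xi≢0) , Ax≡-x) with clearDenominators x
  ... | c , c≢0 , z , z≡cx = z , (i , zi≢0) , zeroSums
    where
    zi≢0 : z i ≢ 0ℤ
    zi≢0 zi≡0 = xi≢0 (p≢0∧p*q≡0⇒q≡0 c≢0 (trans (sym (z≡cx i)) (cong fromℤ zi≡0)))
    Az≡-z : ∀ v → nbhdSumℤ z v ≡ -1ℤ * z v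
    Az≡-z v = fromℤ-injective (begin
      fromℤ (nbhdSumℤ z v)                          ≡⟨ fromℤ-nbhdSum z≡cx v ⟩
      sumℚ (λ u → adjMatrix X v u ℚ.* (c ℚ.* x u))  ≡⟨ sumℚ-scale c (adjMatrix X v) x ⟩
      c ℚ.* sumℚ (λ u → adjMatrix X v u ℚ.* x u)    ≡⟨ cong (c ℚ.*_) (Ax≡-x v) ⟩
      c ℚ.* (- 1ℚ ℚ.* x v)                          ≡⟨ ℚ-*-swapˡ c (- 1ℚ) (x v) ⟩
      - 1ℚ ℚ.* (c ℚ.* x v)                          ≡⟨ cong (- 1ℚ ℚ.*_) (sym (z≡cx v)) ⟩
      - 1ℚ ℚ.* fromℤ (z v)                          ≡⟨ sym (fromℤ-homo-* -1ℤ (z v)) ⟩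
      fromℤ (-1ℤ * z v)                             ∎)
      where open ≡-Reasoning
    zeroSums : ZeroClosedSums z
    zeroSums v = Equivalence.from (x+y≡0⇔y≡-1*x (z v) (nbhdSumℤ z v)) (Az≡-z v)

  zeroClosedSumVector⇒eigenvalue-1 : ZeroClosedSumVector → IsEigenvalue (adjMatrix X) (- 1ℚ)
  zeroClosedSumVector⇒eigenvalue-1 (z , (i , zi≢0) , zeroSums) =
    fromℤ ∘ z , (i , zi≢0 ∘ fromℤ-injective) , Ax≡-x
    where
    open ≡-Reasoning
    Az≡-z : ∀ v → nbhdSumℤ z v ≡ -1ℤ * z v
    Az≡-z v = Equivalence.to (x+y≡0⇔y≡-1*x (z v) (nbhdSumℤ z v)) (zeroSums v)
    Ax≡-x : ∀ v → sumℚ (λ u → adjMatrix X v u ℚ.* fromℤ (z u)) ≡ - 1ℚ ℚ.* fromℤ (z v)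
    Ax≡-x v = begin
      sumℚ (λ u → adjMatrix X v u ℚ.* fromℤ (z u))  ≡⟨ sym (fromℤ-nbhdSum (λ _ → refl) v) ⟩
      fromℤ (nbhdSumℤ z v)                          ≡⟨ cong fromℤ (Az≡-z v) ⟩
      fromℤ (-1ℤ * z v)                             ≡⟨ fromℤ-homo-* -1ℤ (z v) ⟩
      - 1ℚ ℚ.* fromℤ (z v)                          ∎

  eigenvalue-1⇔zeroClosedSumVector : IsEigenvalue (adjMatrix X) (- 1ℚ) ⇔ ZeroClosedSumVector
  eigenvalue-1⇔zeroClosedSumVector =
    mk⇔ eigenvalue-1⇒zeroClosedSumVector zeroClosedSumVector⇒eigenvalue-1

  NontrivialEfficientDominating : Set
  NontrivialEfficientDominating =
    ∃[ j ] ∃[ k ] ∃[ f ] (1 ≤ k × EfficientDominating X j k f × NonConstant f)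

  module _ {r} (regular : Regular X r) where

    nbhdSumℤ-affine : ∀ a g b v → nbhdSumℤ (λ u → a * g u + b) v ≡ a * nbhdSumℤ g v + b * + r
    nbhdSumℤ-affine a g b v = begin
      ∑ℤ.sum (λ u → if adj X v u then a * g u + b else 0ℤ)
        ≡⟨ ∑ℤ.sum-cong-≗ (λ u → split (adj X v u) (g u)) ⟩
      ∑ℤ.sum (λ u → a * G u + b * I u)
        ≡⟨ ∑ℤ.∑-distrib-+ (λ u → a * G u) (λ u → b * I u) ⟩
      ∑ℤ.sum (λ u → a * G u) + ∑ℤ.sum (λ u → b * I u)
        ≡⟨ sym (cong₂ _+_ (∑ℤ.*-distribˡ-sum a G) (∑ℤ.*-distribˡ-sum b I)) ⟩
      a * ∑ℤ.sum G + b * ∑ℤ.sum I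
        ≡⟨ cong (λ d → a * ∑ℤ.sum G + b * d) degree≡r ⟩
      a * nbhdSumℤ g v + b * + r
        ∎
      where
      open ≡-Reasoning
      G I : Fin n → ℤ
      G u = if adj X v u then g u else 0ℤ
      I u = if adj X v u then 1ℤ else 0ℤ
      degree≡r : ∑ℤ.sum I ≡ + r
      degree≡r = trans (sym (pos-nbhdSum (λ _ → 1) v)) (cong +_ (regular v))
      split : ∀ β x → (if β then a * x + b else 0ℤ) ≡
                      a * (if β then x else 0ℤ) + b * (if β then 1ℤ else 0ℤ)
      split true  x = cong (λ s → a * x + s) (sym (ℤP.*-identityʳ b))
      split false x = sym (cong₂ _+_ (ℤP.*-zeroʳ a) (ℤP.*-zeroʳ b))

    closedNbhdSumℤ-affine : ∀ a g b v →
                            closedNbhdSumℤ (λ u → a * g u + b) v ≡ a * closedNbhdSumℤ g v + b * + suc r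
    closedNbhdSumℤ-affine a g b v =
      trans (cong (λ s → a * g v + b + s) (nbhdSumℤ-affine a g b v))
            (identity a (g v) (nbhdSumℤ g v) b (+ r))
      where
      identity : ∀ a x s b r → a * x + b + (a * s + b * r) ≡ a * (x + s) + b * (1ℤ + r)
      identity = solve-∀

    closedNbhdSumℤ-const : ∀ c v → closedNbhdSumℤ (λ _ → c) v ≡ c * + suc r
    closedNbhdSumℤ-const c v = begin
      closedNbhdSumℤ (λ _ → c) v
        ≡⟨ closedNbhdSumℤ-cong (λ _ → sym (ℤP.+-identityˡ c)) v ⟩
      closedNbhdSumℤ (λ _ → 0ℤ * 0ℤ + c) v
        ≡⟨ closedNbhdSumℤ-affine 0ℤ (λ _ → 0ℤ) c v ⟩
      0ℤ * closedNbhdSumℤ (λ _ → 0ℤ) v + c * + suc r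
        ≡⟨ ℤP.+-identityˡ (c * + suc r) ⟩
      c * + suc r
        ∎
      where open ≡-Reasoning

    zeroClosedSums⇒nonConstant : ∀ {z} → ZeroClosedSums z → NonZeroVector z → NonConstant z
    zeroClosedSums⇒nonConstant {z} zeroSums (i , zi≢0) with FinP.all? (λ u → z u ℤ.≟ z i)
    ... | no ¬constant =
      let u , zu≢zi = FinP.¬∀⟶∃¬ n _ (λ u → z u ℤ.≟ z i) ¬constant in u , i , zu≢zi
    ... | yes constant = contradiction (ℤP.*-cancelʳ-≡ (z i) 0ℤ (+ suc r) (begin
      z i * + suc r                 ≡⟨ sym (closedNbhdSumℤ-const (z i) i) ⟩
      closedNbhdSumℤ (λ _ → z i) i  ≡⟨ sym (closedNbhdSumℤ-cong constant i) ⟩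
      closedNbhdSumℤ z i            ≡⟨ zeroSums i ⟩
      0ℤ                            ∎)) zi≢0
      where open ≡-Reasoning

    efficient⇒zeroClosedSums : ∀ {j k f} → EfficientDominating X j k f →
                               ZeroClosedSums (λ u → + suc r * + f u + ℤ.- + k)
    efficient⇒zeroClosedSums {k = k} {f} (_ , f[N]≡k) v = begin
      closedNbhdSumℤ (λ u → + suc r * + f u + ℤ.- + k) v
        ≡⟨ closedNbhdSumℤ-affine (+ suc r) (+_ ∘ f) (ℤ.- + k) v ⟩
      + suc r * closedNbhdSumℤ (+_ ∘ f) v + ℤ.- + k * + suc r
        ≡⟨ cong (λ s → + suc r * s + ℤ.- + k * + suc r) F[N]≡k ⟩
      + suc r * + k + ℤ.- + k * + suc r
        ≡⟨ identity (+ suc r) (+ k) ⟩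
      0ℤ
        ∎
      where
      open ≡-Reasoning
      F[N]≡k : closedNbhdSumℤ (+_ ∘ f) v ≡ + k
      F[N]≡k = trans (sym (pos-closedNbhdSum f v)) (cong +_ (f[N]≡k v))
      identity : ∀ a k → a * k + ℤ.- k * a ≡ 0ℤ
      identity = solve-∀

    zeroClosedSums⇒efficient : ∀ {z c} {f : Fin n → ℕ} →
                               ZeroClosedSums z → (∀ u → + f u ≡ z u + + c) →
                               EfficientDominating X (c ℕ.* suc r) (c ℕ.* suc r) f
    zeroClosedSums⇒efficient {z} {c} {f} zeroSums f≡z+c =
      (λ v → ℕP.≤-trans (ℕP.m≤m+n (f v) _) (ℕP.≤-reflexive (f[N]≡k v))) , f[N]≡k
      where
      open ≡-Reasoning
      f≡1*z+c : ∀ u → + f u ≡ 1ℤ * z u + + c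
      f≡1*z+c u = trans (f≡z+c u) (cong (λ s → s + + c) (sym (ℤP.*-identityˡ (z u))))
      f[N]≡k : ∀ v → closedNbhdSum X f v ≡ c ℕ.* suc r
      f[N]≡k v = ℤP.+-injective (begin
        + closedNbhdSum X f v                    ≡⟨ pos-closedNbhdSum f v ⟩
        closedNbhdSumℤ (+_ ∘ f) v                ≡⟨ closedNbhdSumℤ-cong f≡1*z+c v ⟩
        closedNbhdSumℤ (λ u → 1ℤ * z u + + c) v  ≡⟨ closedNbhdSumℤ-affine 1ℤ z (+ c) v ⟩
        1ℤ * closedNbhdSumℤ z v + + c * + suc r  ≡⟨ cong (λ s → 1ℤ * s + + c * + suc r) (zeroSums v) ⟩
        1ℤ * 0ℤ + + c * + suc r                  ≡⟨ ℤP.+-identityˡ (+ c * + suc r) ⟩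
        + c * + suc r                            ≡⟨ sym (ℤP.pos-* c (suc r)) ⟩
        + (c ℕ.* suc r)                          ∎)

    nontrivialEfficient⇒zeroClosedSumVector : NontrivialEfficientDominating → ZeroClosedSumVector
    nontrivialEfficient⇒zeroClosedSumVector (j , k , f , _ , efficient , nonConstant) =
      g , nonConstant⇒nonZero (nonConstant-reflect g≡⇒f≡ nonConstant) ,
      efficient⇒zeroClosedSums efficient
      where
      g : Fin n → ℤ
      g u = + suc r * + f u + ℤ.- + k
      g≡⇒f≡ : ∀ {u v} → g u ≡ g v → f u ≡ f v
      g≡⇒f≡ = ℤP.+-injective ∘ ℤP.*-cancelˡ-≡ (+ suc r) _ _ ∘ ∙-cancelʳ (ℤ.- + k) _ _

    zeroClosedSumVector⇒nontrivialEfficient : ZeroClosedSumVector → NontrivialEfficientDominating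
    zeroClosedSumVector⇒nontrivialEfficient (z , nonZero , zeroSums) =
      k , k , f , ℕ.s≤s ℕ.z≤n , zeroClosedSums⇒efficient {z} {c} zeroSums (proj₂ ∘ shifted) ,
      nonConstant-reflect f≡⇒z≡ (zeroClosedSums⇒nonConstant zeroSums nonZero)
      where
      -- c exceeds every |z u|, so z + c is ℕ-valued; c ≥ 1 also gives k ≥ 1.
      c k : ℕ
      c = suc (max 0 (tabulate (ℤ.∣_∣ ∘ z)))
      k = c ℕ.* suc r
      shifted : ∀ u → ∃[ m ] + m ≡ z u + + c
      shifted u = shiftToℕ (z u) (ℕP.m≤n⇒m≤1+n (All.tabulate⁻ (xs≤max 0 (tabulate (ℤ.∣_∣ ∘ z))) u))
      f : Fin n → ℕ
      f = proj₁ ∘ shifted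
      f≡⇒z≡ : ∀ {u v} → f u ≡ f v → z u ≡ z v
      f≡⇒z≡ {u} {v} fu≡fv =
        ∙-cancelʳ (+ c) (z u) (z v)
          (trans (sym (proj₂ (shifted u))) (trans (cong +_ fu≡fv) (proj₂ (shifted v))))

    nontrivialEfficient⇔zeroClosedSumVector : NontrivialEfficientDominating ⇔ ZeroClosedSumVector
    nontrivialEfficient⇔zeroClosedSumVector =
      mk⇔ nontrivialEfficient⇒zeroClosedSumVector zeroClosedSumVector⇒nontrivialEfficient

theorem3p5 : (n : ℕ) (X : Graph n) (r : ℕ) → Regular X r →
    (∃[ j ] ∃[ k ] ∃[ f ] (1 ≤ k × EfficientDominating X j k f × NonConstant f))
      ⇔ IsEigenvalue (adjMatrix X) (- 1ℚ)
theorem3p5 n X r regular =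
  ⇔-sym (eigenvalue-1⇔zeroClosedSumVector X) ⇔-∘ nontrivialEfficient⇔zeroClosedSumVector X regular
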